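{- For every graph $G$ of order $n$, $\rho(G)\le s(G)+3n/2$.
   Context: For a graph $G$ with $n$ vertices and $m$ edges, $s(G)=\sum_{u\in V(G)}|d(u)-2m/n|$, with $d(u)$ the degree of $u$. $\rho(G)$ is the minimum number of edges that must be changed (added or deleted) in $G$ to obtain a regular graph, i.e. $\rho(G)=\min\{|E(G)\triangle E(R)| : R \text{ a regular graph on } V(G)\}$. -}

module Defs where

open import Data.Nat using (ℕ; zero; suc; _+_; _*_; _<_; _≤_; ∣_-_∣)
open import Data.Bool using (Bool; true; false; if_then_else_)
open import Data.Fin using (Fin; toℕ)
open import Data.List using (List; map; allFin)
open import Data.Nat.ListAction using (sum)
open import Data.Product using (Σ; ∃; _×_; _,_)
open import Relation.Binary.PropositionalEquality using (_≡_; _≢_)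
open import Relation.Nullary using (yes; no)
open import Data.Nat.Properties using (_<?_)

record Graph (n : ℕ) : Set where
  field
    adj   : Fin n → Fin n → Bool
    sym   : ∀ u v → adj u v ≡ adj v u
    irrefl : ∀ u → adj u u ≡ false
open Graph public

count : ∀ {n} → (Fin n → Bool) → ℕ
count {n} p = sum (map (λ i → if p i then 1 else 0) (allFin n))

-- number of unordered pairs {u,v}, u ≠ v (encoded as toℕ u < toℕ v) satisfying p
countPairs : ∀ {n} → (Fin n → Fin n → Bool) → ℕ
countPairs {n} p =
  sum (map (λ u → sum (map (λ v → pairVal u v) (allFin n))) (allFin n))
  where
  pairVal : Fin n → Fin n → ℕ
  pairVal u v with toℕ u <? toℕ v
  ... | yes _ = if p u v then 1 else 0
  ... | no  _ = 0

deg : ∀ {n} → Graph n → Fin n → ℕ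
deg G u = count (adj G u)

edges : ∀ {n} → Graph n → ℕ
edges G = countPairs (adj G)

Regular : ∀ {n} → Graph n → Set
Regular {n} R = ∃ λ k → ∀ (u : Fin n) → deg R u ≡ k

symDiff : ∀ {n} → Graph n → Graph n → ℕ
symDiff G R = countPairs (λ u v → differ (adj G u v) (adj R u v))
  where
  differ : Bool → Bool → Bool
  differ true  false = true
  differ false true  = true
  differ _     _     = false

IsRho : ∀ {n} → Graph n → ℕ → Set
IsRho G r = (∃ λ R → Regular R × symDiff G R ≡ r)
          × (∀ R → Regular R → r ≤ symDiff G R)

-- n · s(G) = Σ_u | n·d(u) − 2m |   (s(G) with the denominator n cleared)
nTimesS : ∀ {n} → Graph n → ℕ
nTimesS {n} G = sum (map (λ u → ∣ n * deg G u - 2 * edges G ∣) (allFin n))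

-- Fix a target degree k < n with n·k even and |2m − n·k| ≤ n, and let X = Σ (d(u) ∸ k) and
-- Y = Σ (k ∸ d(u)) be the excess and deficit of the degrees. While G is not k-regular, some
-- rewiring of at most three edges (delete an edge between two vertices of degree > k, add one
-- between two vertices of degree < k, move an edge end from a high to a low vertex, or one of
-- two three-edge moves when only high or only low vertices remain) lowers the potential
-- Φ = 2(X + Y) + |X − Y| by at least twice its number of edge changes; the one configuration
-- admitting no such move, X + Y = 1, is excluded because X − Y = 2m − n·k is even. Hence
-- 2ρ(G) ≤ Φ. Finally n(X + Y) = Σ |n·d(u) − n·k| ≤ n·s(G) + n|2m − n·k|, so
-- 2nρ(G) ≤ nΦ ≤ 2n·s(G) + 3n|2m − n·k| ≤ 2n·s(G) + 3n².
module Submission where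

open import Algebra.Properties.Semiring.Sum using ()
open import Data.Bool using (Bool; true; false; _∧_; _∨_; _xor_; if_then_else_)
open import Data.Bool.Properties using (¬-not; ∧-zeroʳ; ∧-comm; ∨-comm; ∨-identityʳ; xor-same; xor-assoc; xor-identityʳ)
  renaming (_≟_ to _≟ᵇ_)
open import Data.Fin using (Fin; zero; suc; toℕ)
open import Data.Fin.Properties using (_≟_; any?; toℕ-injective)
open import Data.List using (map; allFin; tabulate)
open import Data.Nat using (ℕ; zero; suc; NonZero; _+_; _*_; _∸_; _≤_; _<_; z≤n; s≤s; s≤s⁻¹; ∣_-_∣)
open import Data.Nat.Divisibility using (_∣_; divides; _∣0; ∣m+n∣m⇒∣n; m∣m*n; ∣m⇒∣m*n; ∣n⇒∣m*n; ∣1⇒≡1)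
open import Data.Nat.DivMod using (_/_; _%_; m<n*o⇒m/o<n; m/n*n≤m; m≡m%n+[m/n]*n; m%n<n)
open import Data.Nat.Induction using (<-wellFounded)
open import Data.Nat.ListAction using () renaming (sum to listSum)
open import Data.Nat.Properties hiding (_≟_)
open import Data.Nat.Solver using (module +-*-Solver)
open import Data.Product using (∃; _×_; _,_; proj₁; proj₂)
import Data.Product as Product
open import Data.Sum using (_⊎_; inj₁; inj₂)
open import Function using (id)
open import Induction.WellFounded using (Acc; acc)
open import Relation.Binary.Definitions using (tri<; tri≈; tri>)
open import Relation.Binary.PropositionalEquality
open import Relation.Nullary using (¬_; does; yes; no; contradiction)
open import Relation.Nullary.Decidable using (dec-true; dec-false; _×-dec_; ¬?)

open import Defs renaming (sym to adj-sym)

open Algebra.Properties.Semiring.Sum +-*-semiring using (sum-syntax; sum-cong-≗; ∑-distrib-+; ∑-comm; *-distribˡ-sum)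
open +-*-Solver using (solve; _:+_; _:*_; _:=_; con)

-- Finite sums and indicators
𝟙 : Bool → ℕ
𝟙 b = if b then 1 else 0

_==_ : ∀ {n} → Fin n → Fin n → Bool
u == a = does (u ≟ a)

δ : ∀ {n} → Fin n → Fin n → ℕ
δ a i = 𝟙 (i == a)

∑-listSum : ∀ {n} (f : Fin n → ℕ) → listSum (map f (allFin n)) ≡ ∑[ i < n ] f i
∑-listSum f = go f (λ i → i)
  where
  go : ∀ {m n} (f : Fin m → ℕ) (g : Fin n → Fin m) → listSum (map f (tabulate g)) ≡ ∑[ i < n ] f (g i)
  go {n = zero}  f g = refl
  go {n = suc n} f g = cong (f (g zero) +_) (go f (λ i → g (suc i)))

count≡∑ : ∀ {n} (p : Fin n → Bool) → count p ≡ ∑[ i < n ] 𝟙 (p i)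
count≡∑ p = ∑-listSum (λ i → 𝟙 (p i))

∑-mono-≤ : ∀ {n} {f g : Fin n → ℕ} → (∀ i → f i ≤ g i) → ∑[ i < n ] f i ≤ ∑[ i < n ] g i
∑-mono-≤ {zero}  f≤g = z≤n
∑-mono-≤ {suc n} f≤g = +-mono-≤ (f≤g zero) (∑-mono-≤ (λ i → f≤g (suc i)))

∑-const : ∀ n c → ∑[ i < n ] c ≡ n * c
∑-const zero    c = refl
∑-const (suc n) c = cong (c +_) (∑-const n c)

∑-zero : ∀ n → ∑[ i < n ] 0 ≡ 0
∑-zero n = trans (∑-const n 0) (*-zeroʳ n)

∑-δ* : ∀ {n} (a : Fin n) (f : Fin n → ℕ) → ∑[ i < n ] (δ a i * f i) ≡ f a
∑-δ* {suc n} zero    f = trans (cong₂ _+_ (*-identityˡ (f zero)) (∑-zero n)) (+-identityʳ _)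
∑-δ* {suc n} (suc a) f = ∑-δ* a (λ i → f (suc i))

∑-δ : ∀ {n} (a : Fin n) → ∑[ i < n ] δ a i ≡ 1
∑-δ {suc n} zero    = cong suc (∑-zero n)
∑-δ {suc n} (suc a) = ∑-δ a

∑-supported : ∀ {n} (a : Fin n) {f : Fin n → ℕ} → (∀ i → i ≢ a → f i ≡ 0) → ∑[ i < n ] f i ≡ f a
∑-supported {n} a {f} off = trans (sum-cong-≗ sifted) (∑-δ* a f)
  where
  sifted : ∀ i → f i ≡ δ a i * f i
  sifted i with i ≟ a
  ... | yes refl = sym (+-identityʳ (f i))
  ... | no  i≢a  = off i i≢a

δ≤ : ∀ {n} {f : Fin n → ℕ} {u} → 1 ≤ f u → ∀ i → δ u i ≤ f i
δ≤ {u = u} 1≤fu i with i ≟ u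
... | yes refl = 1≤fu
... | no  _    = z≤n

δ+δ≤ : ∀ {n} {f : Fin n → ℕ} {u v} → u ≢ v → 1 ≤ f u → 1 ≤ f v → ∀ i → δ u i + δ v i ≤ f i
δ+δ≤ {u = u} {v} u≢v 1≤fu 1≤fv i with i ≟ u | i ≟ v
... | yes refl | yes refl = contradiction refl u≢v
... | yes refl | no  _    = 1≤fu
... | no  _    | yes refl = 1≤fv
... | no  _    | no  _    = z≤n

δ+δ-self≤ : ∀ {n} {f : Fin n → ℕ} {u} → 2 ≤ f u → ∀ i → δ u i + δ u i ≤ f i
δ+δ-self≤ {u = u} 2≤fu i with i ≟ u
... | yes refl = 2≤fu
... | no  _    = z≤n

∑-δ+δ : ∀ {n} (u v : Fin n) → ∑[ i < n ] (δ u i + δ v i) ≡ 2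
∑-δ+δ u v = trans (∑-distrib-+ (δ u) (δ v)) (cong₂ _+_ (∑-δ u) (∑-δ v))

𝟙≤1 : ∀ b → 𝟙 b ≤ 1
𝟙≤1 true  = ≤-refl
𝟙≤1 false = z≤n

∨-false : ∀ {x y} → x ∨ y ≡ false → x ≡ false × y ≡ false
∨-false {false} {false} _ = refl , refl

==-false : ∀ {n} {w u : Fin n} → w == u ≡ false → w ≢ u
==-false {w = w} {u} e w≡u = contradiction (trans (sym (dec-true (w ≟ u) w≡u)) e) λ ()

𝟙-xor-triangle : ∀ x y z → 𝟙 (x xor z) ≤ 𝟙 (x xor y) + 𝟙 (y xor z)
𝟙-xor-triangle true  true  true  = z≤n
𝟙-xor-triangle true  true  false = s≤s z≤n
𝟙-xor-triangle true  false true  = z≤n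
𝟙-xor-triangle true  false false = s≤s z≤n
𝟙-xor-triangle false true  true  = s≤s z≤n
𝟙-xor-triangle false true  false = z≤n
𝟙-xor-triangle false false true  = s≤s z≤n
𝟙-xor-triangle false false false = z≤n

𝟙-xor-drop : ∀ x e → (e ≡ true → x ≡ true) → 𝟙 (x xor e) + 𝟙 e ≡ 𝟙 x
𝟙-xor-drop true  true  _ = refl
𝟙-xor-drop false true  h = contradiction (h refl) λ ()
𝟙-xor-drop true  false _ = refl
𝟙-xor-drop false false _ = refl

𝟙-xor-add : ∀ x e → (e ≡ true → x ≡ false) → 𝟙 (x xor e) ≡ 𝟙 x + 𝟙 e
𝟙-xor-add true  true  h = contradiction (h refl) λ ()
𝟙-xor-add false true  _ = refl
𝟙-xor-add true  false _ = refl
𝟙-xor-add false false _ = refl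

𝟙-∨-disjoint : ∀ x y z w → x ∧ z ≡ false → 𝟙 ((x ∧ y) ∨ (z ∧ w)) ≡ 𝟙 y * 𝟙 x + 𝟙 w * 𝟙 z
𝟙-∨-disjoint true  _     true  _     ()
𝟙-∨-disjoint true  true  false true  _ = refl
𝟙-∨-disjoint true  true  false false _ = refl
𝟙-∨-disjoint true  false false true  _ = refl
𝟙-∨-disjoint true  false false false _ = refl
𝟙-∨-disjoint false true  true  true  _ = refl
𝟙-∨-disjoint false true  true  false _ = refl
𝟙-∨-disjoint false true  false true  _ = refl
𝟙-∨-disjoint false true  false false _ = refl
𝟙-∨-disjoint false false true  true  _ = refl
𝟙-∨-disjoint false false true  false _ = refl
𝟙-∨-disjoint false false false true  _ = refl
𝟙-∨-disjoint false false false false _ = refl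

count-<⇒∃ : ∀ {n} (p q : Fin n → Bool) → ∑[ i < n ] 𝟙 (q i) < ∑[ i < n ] 𝟙 (p i) → ∃ λ i → p i ≡ true × q i ≡ false
count-<⇒∃ {suc n} p q q<p with p zero in p₀ | q zero in q₀
... | true  | false = zero , p₀ , q₀
... | true  | true  = Product.map suc id (count-<⇒∃ (λ i → p (suc i)) (λ i → q (suc i)) (s≤s⁻¹ q<p))
... | false | true  = Product.map suc id (count-<⇒∃ (λ i → p (suc i)) (λ i → q (suc i)) (≤-trans (n≤1+n _) q<p))
... | false | false = Product.map suc id (count-<⇒∃ (λ i → p (suc i)) (λ i → q (suc i)) q<p)

upper : ∀ {n} → (Fin n → Fin n → Bool) → Fin n → Fin n → ℕ
upper p u v = 𝟙 (does (toℕ u <? toℕ v) ∧ p u v)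

-- `countPairs` sums an anonymous `where`-helper of Defs; the type of
-- `pairVal≡upper` leaves that helper to unification.
mutual
  countPairs≡∑upper : ∀ {n} (p : Fin n → Fin n → Bool) → countPairs p ≡ ∑[ u < n ] ∑[ v < n ] upper p u v
  countPairs≡∑upper {n} p = trans (∑-listSum {n} _) (sum-cong-≗ (λ u → trans (∑-listSum {n} _) (sum-cong-≗ (pairVal≡upper p u))))

  pairVal≡upper : ∀ {n} (p : Fin n → Fin n → Bool) (u v : Fin n) → _ ≡ 𝟙 (does (toℕ u <? toℕ v) ∧ p u v)
  pairVal≡upper p u v with toℕ u <? toℕ v in eq
  ... | yes _ = cong (λ b → 𝟙 (b ∧ p u v)) (sym (cong does eq))
  ... | no  _ = cong (λ b → 𝟙 (b ∧ p u v)) (sym (cong does eq))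

upper-split : ∀ {n} {p : Fin n → Fin n → Bool} → (∀ u v → p u v ≡ p v u) → (∀ u → p u u ≡ false) →
              ∀ u v → 𝟙 (p u v) ≡ upper p u v + upper p v u
upper-split {p = p} p-sym p-irr u v with <-cmp (toℕ u) (toℕ v)
... | tri< u<v _ v≮u rewrite dec-true (toℕ u <? toℕ v) u<v | dec-false (toℕ v <? toℕ u) v≮u = sym (+-identityʳ _)
... | tri> u≮v _ v<u rewrite dec-false (toℕ u <? toℕ v) u≮v | dec-true (toℕ v <? toℕ u) v<u = cong 𝟙 (p-sym u v)
... | tri≈ _ u≡v _ rewrite toℕ-injective u≡v | p-irr v | ∧-zeroʳ (does (toℕ v <? toℕ v)) = refl

double-countPairs : ∀ {n} {p : Fin n → Fin n → Bool} → (∀ u v → p u v ≡ p v u) → (∀ u → p u u ≡ false) →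
                    2 * countPairs p ≡ ∑[ u < n ] ∑[ v < n ] 𝟙 (p u v)
double-countPairs {n} {p} p-sym p-irr = sym (begin
  ∑[ u < n ] ∑[ v < n ] 𝟙 (p u v)
    ≡⟨ sum-cong-≗ (λ u → sum-cong-≗ (upper-split p-sym p-irr u)) ⟩
  ∑[ u < n ] ∑[ v < n ] (upper p u v + upper p v u)
    ≡⟨ sum-cong-≗ (λ u → ∑-distrib-+ (upper p u) (λ v → upper p v u)) ⟩
  ∑[ u < n ] (∑[ v < n ] upper p u v + ∑[ v < n ] upper p v u)
    ≡⟨ ∑-distrib-+ (λ u → ∑[ v < n ] upper p u v) (λ u → ∑[ v < n ] upper p v u) ⟩
  U + ∑[ u < n ] ∑[ v < n ] upper p v u
    ≡⟨ cong (U +_) (∑-comm (λ u v → upper p v u)) ⟩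
  U + U
    ≡⟨ cong (U +_) (sym (+-identityʳ U)) ⟩
  2 * U
    ≡⟨ cong (2 *_) (sym (countPairs≡∑upper p)) ⟩
  2 * countPairs p ∎)
  where
  open ≡-Reasoning
  U = ∑[ u < n ] ∑[ v < n ] upper p u v

countPairs-cong : ∀ {n} {p q : Fin n → Fin n → Bool} → (∀ u v → p u v ≡ q u v) → countPairs p ≡ countPairs q
countPairs-cong {n} {p} {q} p≗q = begin
  countPairs p                       ≡⟨ countPairs≡∑upper p ⟩
  ∑[ u < n ] ∑[ v < n ] upper p u v  ≡⟨ sum-cong-≗ (λ u → sum-cong-≗ (λ v →
                                          cong (λ b → 𝟙 (does (toℕ u <? toℕ v) ∧ b)) (p≗q u v))) ⟩
  ∑[ u < n ] ∑[ v < n ] upper q u v  ≡⟨ countPairs≡∑upper q ⟨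
  countPairs q                       ∎
  where open ≡-Reasoning

-- Degrees and the edit distance
degree : ∀ {n} → Graph n → Fin n → ℕ
degree {n} G u = ∑[ v < n ] 𝟙 (adj G u v)

deg≡degree : ∀ {n} (G : Graph n) (u : Fin n) → deg G u ≡ degree G u
deg≡degree G u = count≡∑ (adj G u)

handshake : ∀ {n} (G : Graph n) → ∑[ u < n ] degree G u ≡ 2 * edges G
handshake G = sym (double-countPairs (adj-sym G) (irrefl G))

distance : ∀ {n} → Graph n → Graph n → ℕ
distance {n} G H = ∑[ u < n ] ∑[ v < n ] 𝟙 (adj G u v xor adj H u v)

-- As for `countPairs`, the type of `differ≡xor` leaves symDiff's helper to unification.
mutual
  symDiff≡countPairs-xor : ∀ {n} (G H : Graph n) → symDiff G H ≡ countPairs (λ u v → adj G u v xor adj H u v)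
  symDiff≡countPairs-xor G H = countPairs-cong (differ≡xor G H)

  differ≡xor : ∀ {n} (G H : Graph n) (u v : Fin n) → _ ≡ adj G u v xor adj H u v
  differ≡xor G H u v with adj G u v | adj H u v
  ... | true  | true  = refl
  ... | true  | false = refl
  ... | false | true  = refl
  ... | false | false = refl

2*symDiff≡distance : ∀ {n} (G H : Graph n) → 2 * symDiff G H ≡ distance G H
2*symDiff≡distance G H = trans (cong (2 *_) (symDiff≡countPairs-xor G H))
  (double-countPairs (λ u v → cong₂ _xor_ (adj-sym G u v) (adj-sym H u v)) (λ u → cong₂ _xor_ (irrefl G u) (irrefl H u)))

distance-refl : ∀ {n} (G : Graph n) → distance G G ≡ 0
distance-refl {n} G = begin
  ∑[ u < n ] ∑[ v < n ] 𝟙 (adj G u v xor adj G u v) ≡⟨ sum-cong-≗ (λ u → sum-cong-≗ (λ v → cong 𝟙 (xor-same (adj G u v)))) ⟩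
  ∑[ u < n ] ∑[ v < n ] 0                          ≡⟨ sum-cong-≗ {n} (λ _ → ∑-zero n) ⟩
  ∑[ u < n ] 0                                     ≡⟨ ∑-zero n ⟩
  0                                                ∎
  where open ≡-Reasoning

distance-triangle : ∀ {n} (G H K : Graph n) → distance G K ≤ distance G H + distance H K
distance-triangle {n} G H K = begin
  distance G K
    ≤⟨ ∑-mono-≤ (λ u → ∑-mono-≤ (λ v → 𝟙-xor-triangle (adj G u v) (adj H u v) (adj K u v))) ⟩
  ∑[ u < n ] ∑[ v < n ] (𝟙 (adj G u v xor adj H u v) + 𝟙 (adj H u v xor adj K u v))
    ≡⟨ sum-cong-≗ (λ u → ∑-distrib-+ (λ v → 𝟙 (adj G u v xor adj H u v)) (λ v → 𝟙 (adj H u v xor adj K u v))) ⟩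
  ∑[ u < n ] (∑[ v < n ] 𝟙 (adj G u v xor adj H u v) + ∑[ v < n ] 𝟙 (adj H u v xor adj K u v))
    ≡⟨ ∑-distrib-+ (λ u → ∑[ v < n ] 𝟙 (adj G u v xor adj H u v)) (λ u → ∑[ v < n ] 𝟙 (adj H u v xor adj K u v)) ⟩
  distance G H + distance H K ∎
  where open ≤-Reasoning

-- Toggling one pair of vertices
singleEdge : ∀ {n} → Fin n → Fin n → Fin n → Fin n → Bool
singleEdge a b u v = (u == a ∧ v == b) ∨ (u == b ∧ v == a)

==-disjoint : ∀ {n} {a b : Fin n} → a ≢ b → ∀ u → (u == a) ∧ (u == b) ≡ false
==-disjoint {a = a} {b} a≢b u with u ≟ a
... | yes refl = dec-false (u ≟ b) a≢b
... | no  _    = refl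

singleEdge-sym : ∀ {n} (a b u v : Fin n) → singleEdge a b u v ≡ singleEdge a b v u
singleEdge-sym a b u v = trans (cong₂ _∨_ (∧-comm (u == a) (v == b)) (∧-comm (u == b) (v == a))) (∨-comm (v == b ∧ u == a) (v == a ∧ u == b))

singleEdge-irrefl : ∀ {n} {a b : Fin n} → a ≢ b → ∀ u → singleEdge a b u u ≡ false
singleEdge-irrefl {a = a} {b} a≢b u rewrite ∧-comm (u == b) (u == a) | ==-disjoint a≢b u = refl

singleEdge-true : ∀ {n} {a b u v : Fin n} → singleEdge a b u v ≡ true → (u ≡ a × v ≡ b) ⊎ (u ≡ b × v ≡ a)
singleEdge-true {a = a} {b} {u} {v} e with u ≟ a | v ≟ b | u ≟ b | v ≟ a
... | yes u≡a | yes v≡b | _       | _       = inj₁ (u≡a , v≡b)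
... | _       | _       | yes u≡b | yes v≡a = inj₂ (u≡b , v≡a)
... | yes _   | no  _   | yes _   | no  _   = contradiction e λ ()
... | yes _   | no  _   | no  _   | _       = contradiction e λ ()
... | no  _   | _       | yes _   | no  _   = contradiction e λ ()
... | no  _   | _       | no  _   | _       = contradiction e λ ()

singleEdge-away : ∀ {n} {a b u : Fin n} → u ≢ a → u ≢ b → ∀ v → singleEdge a b u v ≡ false
singleEdge-away {a = a} {b} {u} u≢a u≢b v rewrite dec-false (u ≟ a) u≢a | dec-false (u ≟ b) u≢b = refl

singleEdge-avoid : ∀ {n} {a b u v : Fin n} → u ≢ b → v ≢ b → singleEdge a b u v ≡ false
singleEdge-avoid {a = a} {b} {u} {v} u≢b v≢b rewrite dec-false (u ≟ b) u≢b | dec-false (v ≟ b) v≢b = trans (∨-identityʳ _) (∧-zeroʳ (u == a))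

∑-singleEdge : ∀ {n} {a b : Fin n} → a ≢ b → ∀ u → ∑[ v < n ] 𝟙 (singleEdge a b u v) ≡ δ a u + δ b u
∑-singleEdge {n} {a} {b} a≢b u = begin
  ∑[ v < n ] 𝟙 (singleEdge a b u v)           ≡⟨ sum-cong-≗ (λ v → 𝟙-∨-disjoint (u == a) (v == b) (u == b) (v == a) (==-disjoint a≢b u)) ⟩
  ∑[ v < n ] (δ b v * δ a u + δ a v * δ b u)  ≡⟨ ∑-distrib-+ (λ v → δ b v * δ a u) (λ v → δ a v * δ b u) ⟩
  ∑[ v < n ] (δ b v * δ a u) + ∑[ v < n ] (δ a v * δ b u) ≡⟨ cong₂ _+_ (∑-δ* b (λ _ → δ a u)) (∑-δ* a (λ _ → δ b u)) ⟩
  δ a u + δ b u                               ∎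
  where open ≡-Reasoning

toggle : ∀ {n} (G : Graph n) (a b : Fin n) → a ≢ b → Graph n
toggle G a b a≢b = record
  { adj    = λ u v → adj G u v xor singleEdge a b u v
  ; sym    = λ u v → cong₂ _xor_ (adj-sym G u v) (singleEdge-sym a b u v)
  ; irrefl = λ u → cong₂ _xor_ (irrefl G u) (singleEdge-irrefl a≢b u)
  }

adj-singleEdge : ∀ {n} (G : Graph n) {a b u v : Fin n} → singleEdge a b u v ≡ true → adj G u v ≡ adj G a b
adj-singleEdge G {a} {b} {u} {v} e with singleEdge-true {a = a} {b} {u} {v} e
... | inj₁ (refl , refl) = refl
... | inj₂ (refl , refl) = adj-sym G _ _

module _ {n} (G : Graph n) {a b : Fin n} (a≢b : a ≢ b) where

  private
    G′ = toggle G a b a≢b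

  degree-toggle-edge : adj G a b ≡ true → ∀ i → degree G′ i + (δ a i + δ b i) ≡ degree G i
  degree-toggle-edge ab i = begin
    degree G′ i + (δ a i + δ b i)
      ≡⟨ cong (degree G′ i +_) (∑-singleEdge a≢b i) ⟨
    degree G′ i + ∑[ v < n ] 𝟙 (singleEdge a b i v)
      ≡⟨ ∑-distrib-+ (λ v → 𝟙 (adj G′ i v)) (λ v → 𝟙 (singleEdge a b i v)) ⟨
    ∑[ v < n ] (𝟙 (adj G′ i v) + 𝟙 (singleEdge a b i v))
      ≡⟨ sum-cong-≗ (λ v → 𝟙-xor-drop (adj G i v) (singleEdge a b i v) (λ e → trans (adj-singleEdge G e) ab)) ⟩
    degree G i ∎
    where open ≡-Reasoning

  degree-toggle-nonedge : adj G a b ≡ false → ∀ i → degree G′ i ≡ degree G i + (δ a i + δ b i)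
  degree-toggle-nonedge ab i = begin
    degree G′ i
      ≡⟨ sum-cong-≗ (λ v → 𝟙-xor-add (adj G i v) (singleEdge a b i v) (λ e → trans (adj-singleEdge G e) ab)) ⟩
    ∑[ v < n ] (𝟙 (adj G i v) + 𝟙 (singleEdge a b i v))
      ≡⟨ ∑-distrib-+ (λ v → 𝟙 (adj G i v)) (λ v → 𝟙 (singleEdge a b i v)) ⟩
    degree G i + ∑[ v < n ] 𝟙 (singleEdge a b i v)
      ≡⟨ cong (degree G i +_) (∑-singleEdge a≢b i) ⟩
    degree G i + (δ a i + δ b i) ∎
    where open ≡-Reasoning

  toggle-adjˡ : ∀ {u} → u ≢ a → u ≢ b → ∀ v → adj G′ u v ≡ adj G u v
  toggle-adjˡ u≢a u≢b v = trans (cong (adj G _ v xor_) (singleEdge-away u≢a u≢b v)) (xor-identityʳ _)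

  toggle-adj-avoid : ∀ {u v} → u ≢ b → v ≢ b → adj G′ u v ≡ adj G u v
  toggle-adj-avoid u≢b v≢b = trans (cong (adj G _ _ xor_) (singleEdge-avoid u≢b v≢b)) (xor-identityʳ _)

  distance-toggle : distance G G′ ≡ 2
  distance-toggle = begin
    ∑[ u < n ] ∑[ v < n ] 𝟙 (adj G u v xor (adj G u v xor singleEdge a b u v))
      ≡⟨ sum-cong-≗ (λ u → sum-cong-≗ (λ v → cong 𝟙 (xor-cancel (adj G u v) (singleEdge a b u v)))) ⟩
    ∑[ u < n ] ∑[ v < n ] 𝟙 (singleEdge a b u v)
      ≡⟨ sum-cong-≗ (∑-singleEdge a≢b) ⟩
    ∑[ u < n ] (δ a u + δ b u)
      ≡⟨ ∑-distrib-+ (δ a) (δ b) ⟩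
    ∑[ u < n ] δ a u + ∑[ u < n ] δ b u
      ≡⟨ cong₂ _+_ (∑-δ a) (∑-δ b) ⟩
    2 ∎
    where
    open ≡-Reasoning
    xor-cancel : ∀ x e → x xor (x xor e) ≡ e
    xor-cancel x e = trans (sym (xor-assoc x x e)) (cong (_xor e) (xor-same x))

-- Counting in neighbourhoods
module _ {n} (G : Graph n) where

  ∑-adj-∨-== : ∀ {x z} → adj G x z ≡ false → ∑[ w < n ] 𝟙 (adj G x w ∨ (w == z)) ≡ suc (degree G x)
  ∑-adj-∨-== {x} {z} xz = begin
    ∑[ w < n ] 𝟙 (adj G x w ∨ (w == z)) ≡⟨ sum-cong-≗ split ⟩
    ∑[ w < n ] (𝟙 (adj G x w) + δ z w)  ≡⟨ ∑-distrib-+ (λ w → 𝟙 (adj G x w)) (δ z) ⟩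
    degree G x + ∑[ w < n ] δ z w       ≡⟨ cong (degree G x +_) (∑-δ z) ⟩
    degree G x + 1                      ≡⟨ +-comm (degree G x) 1 ⟩
    suc (degree G x)                    ∎
    where
    open ≡-Reasoning
    split : ∀ w → 𝟙 (adj G x w ∨ (w == z)) ≡ 𝟙 (adj G x w) + δ z w
    split w with w ≟ z
    ... | yes refl rewrite xz = refl
    ... | no  _    = trans (cong 𝟙 (∨-identityʳ (adj G x w))) (sym (+-identityʳ _))

  degree<n : ∀ u → degree G u < n
  degree<n u = begin-strict
    degree G u                          <⟨ n<1+n _ ⟩
    suc (degree G u)                    ≡⟨ ∑-adj-∨-== (irrefl G u) ⟨
    ∑[ w < n ] 𝟙 (adj G u w ∨ (w == u)) ≤⟨ ∑-mono-≤ {n} (λ w → 𝟙≤1 (adj G u w ∨ (w == u))) ⟩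
    ∑[ w < n ] 1                        ≡⟨ ∑-const n 1 ⟩
    n * 1                               ≡⟨ *-identityʳ n ⟩
    n                                   ∎
    where open ≤-Reasoning

  ∃-neighbour : ∀ {u} → 0 < degree G u → ∃ λ w → adj G u w ≡ true
  ∃-neighbour {u} 0<d = Product.map id proj₁ (count-<⇒∃ (adj G u) (λ _ → false) (subst (_< degree G u) (sym (∑-zero n)) 0<d))

  ∃-non-neighbour : ∀ {u} → suc (degree G u) < n → ∃ λ w → adj G u w ≡ false × w ≢ u
  ∃-non-neighbour {u} d+1<n with count-<⇒∃ (λ _ → true) (λ w → adj G u w ∨ (w == u)) closed<n
    where
    closed<n : ∑[ w < n ] 𝟙 (adj G u w ∨ (w == u)) < ∑[ w < n ] 1
    closed<n = subst₂ _<_ (sym (∑-adj-∨-== (irrefl G u))) (sym (trans (∑-const n 1) (*-identityʳ n))) d+1<n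
  ... | w , _ , outside with ∨-false outside
  ... | uw , w≠u = w , uw , ==-false w≠u

  Pivot : Fin n → Fin n → Fin n → Set
  Pivot x y w = adj G x w ≡ true × adj G y w ≡ false × w ≢ y

  ∃-outside-closedNbhd : ∀ (p : Fin n → Bool) {y} → suc (degree G y) < ∑[ w < n ] 𝟙 (p w) →
                         ∃ λ w → p w ≡ true × adj G y w ≡ false × w ≢ y
  ∃-outside-closedNbhd p {y} bound with count-<⇒∃ p (λ w → adj G y w ∨ (w == y)) (subst (_< _) (sym (∑-adj-∨-== (irrefl G y))) bound)
  ... | w , pw , outside with ∨-false outside
  ... | yw , w≠y = w , pw , yw , ==-false w≠y

  ∃-pivot : ∀ {x y} → suc (degree G y) < degree G x → ∃ (Pivot x y)
  ∃-pivot = ∃-outside-closedNbhd (adj G _)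

  ∃-pivot-of-reverse : ∀ {x y z} → adj G y z ≡ true → adj G x z ≡ false → degree G y < degree G x → ∃ (Pivot x y)
  ∃-pivot-of-reverse {x} {y} {z} yz xz gap with ∃-outside-closedNbhd (λ w → adj G x w ∨ (w == z)) bound
    where
    bound : suc (degree G y) < ∑[ w < n ] 𝟙 (adj G x w ∨ (w == z))
    bound = subst (suc (degree G y) <_) (sym (∑-adj-∨-== xz)) (s≤s gap)
  ... | w , xw∨w=z , yw , w≢y = w , xw , yw , w≢y
    where
    w≢z : w ≢ z
    w≢z refl = contradiction (trans (sym yw) yz) λ ()
    xw : adj G x w ≡ true
    xw = trans (sym (∨-identityʳ (adj G x w))) (trans (cong (adj G x w ∨_) (sym (dec-false (w ≟ z) w≢z))) xw∨w=z)

-- Rewirings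
adj⇒≢ : ∀ {n} (G : Graph n) {u v : Fin n} → adj G u v ≡ true → u ≢ v
adj⇒≢ G {u} uv refl = contradiction (trans (sym uv) (irrefl G u)) λ ()

record Rewiring {n} (G : Graph n) (cost : ℕ) (c c′ : Fin n → ℕ) : Set where
  field
    result  : Graph n
    degrees : ∀ i → degree result i + c i ≡ degree G i + c′ i
    close   : distance G result ≤ 2 * cost
open Rewiring

delete : ∀ {n} (G : Graph n) {a b} → adj G a b ≡ true → Rewiring G 1 (λ i → δ a i + δ b i) (λ _ → 0)
delete G ab = record
  { result  = toggle G _ _ (adj⇒≢ G ab)
  ; degrees = λ i → trans (degree-toggle-edge G (adj⇒≢ G ab) ab i) (sym (+-identityʳ _))
  ; close   = ≤-reflexive (distance-toggle G (adj⇒≢ G ab))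
  }

add : ∀ {n} (G : Graph n) {a b} → a ≢ b → adj G a b ≡ false → Rewiring G 1 (λ _ → 0) (λ i → δ a i + δ b i)
add G a≢b ab = record
  { result  = toggle G _ _ a≢b
  ; degrees = λ i → trans (+-identityʳ _) (degree-toggle-nonedge G a≢b ab i)
  ; close   = ≤-reflexive (distance-toggle G a≢b)
  }

transfer : ∀ {n} (G : Graph n) {x y w} → Pivot G x y w → Rewiring G 2 (δ x) (δ y)
transfer G {x} {y} {w} (xw , yw , w≢y) = record
  { result  = G₂
  ; degrees = shifted
  ; close   = ≤-trans (distance-triangle G G₁ G₂) (≤-reflexive (cong₂ _+_ (distance-toggle G x≢w) (distance-toggle G₁ y≢w)))
  }
  where
  x≢w = adj⇒≢ G xw
  y≢w = ≢-sym w≢y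
  G₁ = toggle G x w x≢w
  G₂ = toggle G₁ y w y≢w
  y≢x : y ≢ x
  y≢x refl = contradiction (trans (sym xw) yw) λ ()
  yw₁ : adj G₁ y w ≡ false
  yw₁ = trans (toggle-adjˡ G x≢w y≢x y≢w w) yw
  shifted : ∀ i → degree G₂ i + δ x i ≡ degree G i + δ y i
  shifted i = begin
    degree G₂ i + δ x i                      ≡⟨ cong (_+ δ x i) (degree-toggle-nonedge G₁ y≢w yw₁ i) ⟩
    (degree G₁ i + (δ y i + δ w i)) + δ x i  ≡⟨ solve 4 (λ d y w x → (d :+ (y :+ w)) :+ x := (d :+ (x :+ w)) :+ y) refl
                                                   (degree G₁ i) (δ y i) (δ w i) (δ x i) ⟩
    (degree G₁ i + (δ x i + δ w i)) + δ y i  ≡⟨ cong (_+ δ y i) (degree-toggle-edge G x≢w xw i) ⟩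
    degree G i + δ y i                       ∎
    where open ≡-Reasoning

transfer-adj : ∀ {n} (G : Graph n) {x y w} (P : Pivot G x y w) {u v} → u ≢ w → v ≢ w → adj (result (transfer G P)) u v ≡ adj G u v
transfer-adj G (xw , yw , w≢y) u≢w v≢w =
  trans (toggle-adj-avoid (toggle G _ _ (adj⇒≢ G xw)) (≢-sym w≢y) u≢w v≢w) (toggle-adj-avoid G (adj⇒≢ G xw) u≢w v≢w)

transfer-delete : ∀ {n} (G : Graph n) {a b p q} → Pivot G a b p → adj G q b ≡ true → q ≢ p →
                  Rewiring G 3 (λ i → δ q i + δ a i) (λ _ → 0)
transfer-delete G {a} {b} {p} {q} P qb q≢p = record
  { result  = result D
  ; degrees = λ i → +-cancelʳ-≡ (δ b i) _ _ (shifted i)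
  ; close   = ≤-trans (distance-triangle G (result T) (result D)) (+-mono-≤ (close T) (close D))
  }
  where
  T = transfer G P
  D = delete (result T) (trans (transfer-adj G P q≢p (≢-sym (proj₂ (proj₂ P)))) qb)
  shifted : ∀ i → (degree (result D) i + (δ q i + δ a i)) + δ b i ≡ (degree G i + 0) + δ b i
  shifted i = begin
    (degree (result D) i + (δ q i + δ a i)) + δ b i ≡⟨ solve 4 (λ d q a b → (d :+ (q :+ a)) :+ b := (d :+ (q :+ b)) :+ a) refl
                                                          (degree (result D) i) (δ q i) (δ a i) (δ b i) ⟩
    (degree (result D) i + (δ q i + δ b i)) + δ a i ≡⟨ cong (_+ δ a i) (trans (degrees D i) (+-identityʳ _)) ⟩
    degree (result T) i + δ a i                     ≡⟨ degrees T i ⟩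
    degree G i + δ b i                              ≡⟨ cong (_+ δ b i) (+-identityʳ _) ⟨
    (degree G i + 0) + δ b i                        ∎
    where open ≡-Reasoning

transfer-add : ∀ {n} (G : Graph n) {a b p q} → Pivot G a b p → adj G q a ≡ false → q ≢ a → q ≢ p →
               Rewiring G 3 (λ _ → 0) (λ i → δ q i + δ b i)
transfer-add G {a} {b} {p} {q} P qa q≢a q≢p = record
  { result  = result A
  ; degrees = shifted
  ; close   = ≤-trans (distance-triangle G (result T) (result A)) (+-mono-≤ (close T) (close A))
  }
  where
  T = transfer G P
  A = add (result T) q≢a (trans (transfer-adj G P q≢p (adj⇒≢ G (proj₁ P))) qa)
  shifted : ∀ i → degree (result A) i + 0 ≡ degree G i + (δ q i + δ b i)
  shifted i = begin
    degree (result A) i + 0                ≡⟨ degrees A i ⟩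
    degree (result T) i + (δ q i + δ a i)  ≡⟨ solve 3 (λ d q a → d :+ (q :+ a) := (d :+ a) :+ q) refl (degree (result T) i) (δ q i) (δ a i) ⟩
    (degree (result T) i + δ a i) + δ q i  ≡⟨ cong (_+ δ q i) (degrees T i) ⟩
    (degree G i + δ b i) + δ q i           ≡⟨ solve 3 (λ d b q → (d :+ b) :+ q := d :+ (q :+ b)) refl (degree G i) (δ b i) (δ q i) ⟩
    degree G i + (δ q i + δ b i)           ∎
    where open ≡-Reasoning

-- The potential
∸-lower : ∀ k {d d′ c} → k ≤ d → d′ + c ≡ d → c ≤ d ∸ k → (d′ ∸ k) + c ≡ d ∸ k × k ≤ d′
∸-lower k {d} {d′} {c} k≤d d′+c≡d c≤ = trans (sym (+-∸-comm c k≤d′)) (cong (_∸ k) d′+c≡d) , k≤d′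
  where
  k≤d′ : k ≤ d′
  k≤d′ = +-cancelʳ-≤ c k d′ (begin
    k + c        ≤⟨ +-monoʳ-≤ k c≤ ⟩
    k + (d ∸ k)  ≡⟨ m+[n∸m]≡n k≤d ⟩
    d            ≡⟨ d′+c≡d ⟨
    d′ + c       ∎)
    where open ≤-Reasoning

∸-raise : ∀ k {d d′ c′} → d ≤ k → d′ ≡ d + c′ → c′ ≤ k ∸ d → (k ∸ d′) + c′ ≡ k ∸ d × d′ ≤ k
∸-raise k {d} {d′} {c′} d≤k refl c′≤ = trans (cong (_+ c′) (sym (∸-+-assoc k d c′))) (m∸n+n≡m c′≤) , (begin
  d + c′       ≤⟨ +-monoʳ-≤ d c′≤ ⟩
  d + (k ∸ d)  ≡⟨ m+[n∸m]≡n d≤k ⟩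
  k            ∎)
  where open ≤-Reasoning

∸-shift : ∀ k {d d′ c c′} → d′ + c ≡ d + c′ → c ≤ d ∸ k → c′ ≤ k ∸ d →
          (d′ ∸ k) + c ≡ d ∸ k × (k ∸ d′) + c′ ≡ k ∸ d
∸-shift k {d} {d′} {c} {c′} eq c≤ c′≤ with ≤-total k d
... | inj₁ k≤d = proj₁ lowered , trans (cong₂ _+_ (m≤n⇒m∸n≡0 (proj₂ lowered)) c′≡0) (sym (m≤n⇒m∸n≡0 k≤d))
  where
  c′≡0 : c′ ≡ 0
  c′≡0 = n≤0⇒n≡0 (subst (c′ ≤_) (m≤n⇒m∸n≡0 k≤d) c′≤)
  lowered = ∸-lower k k≤d (trans eq (trans (cong (d +_) c′≡0) (+-identityʳ d))) c≤
... | inj₂ d≤k = trans (cong₂ _+_ (m≤n⇒m∸n≡0 (proj₂ raised)) c≡0) (sym (m≤n⇒m∸n≡0 d≤k)) , proj₁ raised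
  where
  c≡0 : c ≡ 0
  c≡0 = n≤0⇒n≡0 (subst (c ≤_) (m≤n⇒m∸n≡0 d≤k) c≤)
  raised = ∸-raise k d≤k (trans (sym (trans (cong (d′ +_) c≡0) (+-identityʳ d′))) eq) c′≤

+-∸-balance : ∀ d k → d + (k ∸ d) ≡ k + (d ∸ k)
+-∸-balance d k with ≤-total d k
... | inj₁ d≤k = trans (m+[n∸m]≡n d≤k) (sym (trans (cong (k +_) (m≤n⇒m∸n≡0 d≤k)) (+-identityʳ k)))
... | inj₂ k≤d = trans (trans (cong (d +_) (m≤n⇒m∸n≡0 k≤d)) (+-identityʳ d)) (sym (m+[n∸m]≡n k≤d))

∸+∸≡∣-∣ : ∀ m n → (m ∸ n) + (n ∸ m) ≡ ∣ m - n ∣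
∸+∸≡∣-∣ zero    zero    = refl
∸+∸≡∣-∣ zero    (suc n) = refl
∸+∸≡∣-∣ (suc m) zero    = +-identityʳ _
∸+∸≡∣-∣ (suc m) (suc n) = ∸+∸≡∣-∣ m n

+≡+⇒∣-∣≡∣-∣ : ∀ {a b x y} → a + y ≡ b + x → ∣ x - y ∣ ≡ ∣ a - b ∣
+≡+⇒∣-∣≡∣-∣ {a} {b} {x} {y} a+y≡b+x = begin
  ∣ x - y ∣             ≡⟨ ∣m+n-m+o∣≡∣n-o∣ b x y ⟨
  ∣ b + x - b + y ∣     ≡⟨ cong (λ z → ∣ z - b + y ∣) a+y≡b+x ⟨
  ∣ a + y - b + y ∣     ≡⟨ cong₂ ∣_-_∣ (+-comm a y) (+-comm b y) ⟩
  ∣ y + a - y + b ∣     ≡⟨ ∣m+n-m+o∣≡∣n-o∣ y a b ⟩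
  ∣ a - b ∣             ∎
  where open ≡-Reasoning

Φ : ℕ → ℕ → ℕ
Φ x y = 2 * (x + y) + ∣ x - y ∣

Φ-comm : ∀ x y → Φ x y ≡ Φ y x
Φ-comm x y = cong₂ _+_ (cong (2 *_) (+-comm x y)) (∣-∣-comm x y)

Φ-lower : ∀ x y → 2 * 1 + Φ x y ≤ Φ (x + 2) y
Φ-lower x y = begin
  2 * 1 + (2 * (x + y) + ∣ x - y ∣)            ≤⟨ +-monoʳ-≤ 2 (+-monoʳ-≤ (2 * (x + y)) gap) ⟩
  2 * 1 + (2 * (x + y) + (2 + ∣ x + 2 - y ∣))  ≡⟨ solve 3 (λ x y t → con 2 :* con 1 :+ (con 2 :* (x :+ y) :+ (con 2 :+ t))
                                                             := con 2 :* ((x :+ con 2) :+ y) :+ t) refl x y ∣ x + 2 - y ∣ ⟩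
  2 * ((x + 2) + y) + ∣ x + 2 - y ∣            ∎
  where
  open ≤-Reasoning
  gap : ∣ x - y ∣ ≤ 2 + ∣ x + 2 - y ∣
  gap = subst (λ z → ∣ x - y ∣ ≤ z + ∣ x + 2 - y ∣) (∣m-m+n∣≡n x 2) (∣-∣-triangle x (x + 2) y)

Φ-raise : ∀ x y → 2 * 1 + Φ x y ≤ Φ x (y + 2)
Φ-raise x y = subst₂ (λ a b → 2 * 1 + a ≤ b) (Φ-comm y x) (Φ-comm (y + 2) x) (Φ-lower y x)

Φ-lower-unopposed : ∀ x → 2 * 3 + Φ x 0 ≤ Φ (x + 2) 0
Φ-lower-unopposed x rewrite ∣-∣-identityʳ x | ∣-∣-identityʳ (x + 2) =
  ≤-reflexive (solve 1 (λ x → con 2 :* con 3 :+ (con 2 :* (x :+ con 0) :+ x) := con 2 :* ((x :+ con 2) :+ con 0) :+ (x :+ con 2)) refl x)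

Φ-raise-unopposed : ∀ y → 2 * 3 + Φ 0 y ≤ Φ 0 (y + 2)
Φ-raise-unopposed y = subst₂ (λ a b → 2 * 3 + a ≤ b) (Φ-comm y 0) (Φ-comm (y + 2) 0) (Φ-lower-unopposed y)

Φ-balance : ∀ x y → 2 * 2 + Φ x y ≤ Φ (x + 1) (y + 1)
Φ-balance x y rewrite +-comm x 1 | +-comm y 1 =
  ≤-reflexive (solve 3 (λ x y t → con 2 :* con 2 :+ (con 2 :* (x :+ y) :+ t) := con 2 :* ((con 1 :+ x) :+ (con 1 :+ y)) :+ t) refl x y ∣ x - y ∣)

module Balancing {n : ℕ} (k : ℕ) where

  excess : Graph n → ℕ
  excess G = ∑[ i < n ] (degree G i ∸ k)

  deficit : Graph n → ℕ
  deficit G = ∑[ i < n ] (k ∸ degree G i)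

  potential : Graph n → ℕ
  potential G = Φ (excess G) (deficit G)

  High Low : Graph n → Fin n → Set
  High G u = k < degree G u
  Low  G u = degree G u < k

  excess-deficit-balance : ∀ G → 2 * edges G + deficit G ≡ n * k + excess G
  excess-deficit-balance G = begin
    2 * edges G + deficit G                      ≡⟨ cong (_+ deficit G) (handshake G) ⟨
    ∑[ i < n ] degree G i + deficit G            ≡⟨ ∑-distrib-+ (degree G) (λ i → k ∸ degree G i) ⟨
    ∑[ i < n ] (degree G i + (k ∸ degree G i))   ≡⟨ sum-cong-≗ (λ i → +-∸-balance (degree G i) k) ⟩
    ∑[ i < n ] (k + (degree G i ∸ k))            ≡⟨ ∑-distrib-+ (λ _ → k) (λ i → degree G i ∸ k) ⟩
    ∑[ i < n ] k + excess G                      ≡⟨ cong (_+ excess G) (∑-const n k) ⟩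
    n * k + excess G                             ∎
    where open ≡-Reasoning

  excess+deficit-even : 2 ∣ n * k → ∀ G → 2 ∣ excess G + deficit G
  excess+deficit-even 2∣nk G = ∣m+n∣m⇒∣n (subst (2 ∣_) doubled (m∣m*n (edges G + deficit G))) 2∣nk
    where
    doubled : 2 * (edges G + deficit G) ≡ n * k + (excess G + deficit G)
    doubled = begin
      2 * (edges G + deficit G)            ≡⟨ solve 2 (λ e d → con 2 :* (e :+ d) := (con 2 :* e :+ d) :+ d) refl (edges G) (deficit G) ⟩
      (2 * edges G + deficit G) + deficit G ≡⟨ cong (_+ deficit G) (excess-deficit-balance G) ⟩
      (n * k + excess G) + deficit G        ≡⟨ +-assoc (n * k) (excess G) (deficit G) ⟩
      n * k + (excess G + deficit G)        ∎
      where open ≡-Reasoning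

  excess-deficit-shift : ∀ {G cost c c′} (r : Rewiring G cost c c′) →
                         (∀ i → c i ≤ degree G i ∸ k) → (∀ i → c′ i ≤ k ∸ degree G i) →
                         excess (result r) + ∑[ i < n ] c i ≡ excess G × deficit (result r) + ∑[ i < n ] c′ i ≡ deficit G
  excess-deficit-shift {c = c} {c′} r c≤ c′≤ =
    trans (sym (∑-distrib-+ _ c)) (sum-cong-≗ (λ i → proj₁ (shift i))) ,
    trans (sym (∑-distrib-+ _ c′)) (sum-cong-≗ (λ i → proj₂ (shift i)))
    where shift = λ i → ∸-shift k (degrees r i) (c≤ i) (c′≤ i)

  record Move (G : Graph n) : Set where
    field
      next     : Graph n
      paid     : distance G next + potential next ≤ potential G
      progress : potential next < potential G

  rewire : ∀ {G cost c c′} (r : Rewiring G (suc cost) c c′) → 2 * suc cost + potential (result r) ≤ potential G → Move G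
  rewire {cost = cost} r descent = record
    { next     = result r
    ; paid     = ≤-trans (+-monoˡ-≤ (potential (result r)) (close r)) descent
    ; progress = <-≤-trans (m<n+m (potential (result r)) {2 * suc cost} (s≤s z≤n)) descent
    }

  lowering : ∀ {G cost c} (r : Rewiring G (suc cost) c (λ _ → 0)) → ∑[ i < n ] c i ≡ 2 → (∀ i → c i ≤ degree G i ∸ k) →
             (∀ x → 2 * suc cost + Φ x (deficit G) ≤ Φ (x + 2) (deficit G)) → Move G
  lowering {G} {cost} r ∑c≡2 c≤ affordable =
    rewire r (subst₂ (λ y x → 2 * suc cost + Φ (excess G′) y ≤ Φ x (deficit G)) (sym e₂) e₁ (affordable (excess G′)))
    where
    G′ = result r
    shift = excess-deficit-shift r c≤ (λ _ → z≤n)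
    e₁ : excess G′ + 2 ≡ excess G
    e₁ = trans (cong (excess G′ +_) (sym ∑c≡2)) (proj₁ shift)
    e₂ : deficit G′ ≡ deficit G
    e₂ = trans (sym (trans (cong (deficit G′ +_) (∑-zero n)) (+-identityʳ _))) (proj₂ shift)

  raising : ∀ {G cost c′} (r : Rewiring G (suc cost) (λ _ → 0) c′) → ∑[ i < n ] c′ i ≡ 2 → (∀ i → c′ i ≤ k ∸ degree G i) →
            (∀ y → 2 * suc cost + Φ (excess G) y ≤ Φ (excess G) (y + 2)) → Move G
  raising {G} {cost} r ∑c′≡2 c′≤ affordable =
    rewire r (subst₂ (λ x y → 2 * suc cost + Φ x (deficit G′) ≤ Φ (excess G) y) (sym e₁) e₂ (affordable (deficit G′)))
    where
    G′ = result r
    shift = excess-deficit-shift r (λ _ → z≤n) c′≤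
    e₁ : excess G′ ≡ excess G
    e₁ = trans (sym (trans (cong (excess G′ +_) (∑-zero n)) (+-identityʳ _))) (proj₁ shift)
    e₂ : deficit G′ + 2 ≡ deficit G
    e₂ = trans (cong (deficit G′ +_) (sym ∑c′≡2)) (proj₂ shift)

  balancing : ∀ {G u v} (r : Rewiring G 2 (δ u) (δ v)) → High G u → Low G v → Move G
  balancing {G} {u} {v} r high low = rewire r (subst₂ (λ x y → 2 * 2 + potential G′ ≤ Φ x y) e₁ e₂ (Φ-balance (excess G′) (deficit G′)))
    where
    G′ = result r
    shift = excess-deficit-shift r (δ≤ (m<n⇒0<n∸m high)) (δ≤ (m<n⇒0<n∸m low))
    e₁ : excess G′ + 1 ≡ excess G
    e₁ = trans (cong (excess G′ +_) (sym (∑-δ u))) (proj₁ shift)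
    e₂ : deficit G′ + 1 ≡ deficit G
    e₂ = trans (cong (deficit G′ +_) (sym (∑-δ v))) (proj₂ shift)

  excess≡0 : ∀ G → (∀ i → ¬ High G i) → excess G ≡ 0
  excess≡0 G noHigh = trans (sum-cong-≗ (λ i → m≤n⇒m∸n≡0 (≮⇒≥ (noHigh i)))) (∑-zero n)

  deficit≡0 : ∀ G → (∀ i → ¬ Low G i) → deficit G ≡ 0
  deficit≡0 G noLow = trans (sum-cong-≗ (λ i → m≤n⇒m∸n≡0 (≮⇒≥ (noLow i)))) (∑-zero n)

  delete-high : ∀ {G u v} → adj G u v ≡ true → High G u → High G v → Move G
  delete-high {G} uv hu hv =
    lowering (delete G uv) (∑-δ+δ {n} _ _) (δ+δ≤ (adj⇒≢ G uv) (m<n⇒0<n∸m hu) (m<n⇒0<n∸m hv)) (λ x → Φ-lower x (deficit G))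

  add-low : ∀ {G u v} → u ≢ v → adj G u v ≡ false → Low G u → Low G v → Move G
  add-low {G} u≢v uv lu lv =
    raising (add G u≢v uv) (∑-δ+δ {n} _ _) (δ+δ≤ u≢v (m<n⇒0<n∸m lu) (m<n⇒0<n∸m lv)) (Φ-raise (excess G))

  transfer-high-low : ∀ {G u v} → High G u → Low G v → Move G
  transfer-high-low {G} hu lv = balancing (transfer G (proj₂ (∃-pivot G (≤-trans (s≤s lv) hu)))) hu lv

  split-off-at : ∀ {G u w} → adj G u w ≡ true → degree G w ≤ k → suc k < degree G u → deficit G ≡ 0 → Move G
  split-off-at {G} {u} uw w≤k excess≥2 noDeficit =
    lowering (transfer-delete G P uw (adj⇒≢ G (proj₁ P))) (∑-δ+δ u u) (δ+δ-self≤ (m+n≤o⇒m≤o∸n 2 excess≥2))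
      (λ x → subst (λ y → 2 * 3 + Φ x y ≤ Φ (x + 2) y) (sym noDeficit) (Φ-lower-unopposed x))
    where
    P = proj₂ (∃-pivot G (≤-trans (s≤s (s≤s w≤k)) excess≥2))

  split-off-between : ∀ {G u v w} → u ≢ v → adj G u v ≡ false → adj G u w ≡ true → degree G w ≤ k →
                      High G u → High G v → deficit G ≡ 0 → Move G
  split-off-between {G} {u} {v} {w} u≢v uv uw w≤k hu hv noDeficit =
    lowering (transfer-delete G P uw u≢x) (∑-δ+δ u v) (δ+δ≤ u≢v (m<n⇒0<n∸m hu) (m<n⇒0<n∸m hv))
      (λ x → subst (λ y → 2 * 3 + Φ x y ≤ Φ (x + 2) y) (sym noDeficit) (Φ-lower-unopposed x))
    where
    pivot = ∃-pivot-of-reverse G (trans (adj-sym G w u) uw) (trans (adj-sym G v u) uv) (≤-<-trans w≤k hv)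
    P = proj₂ pivot
    u≢x : u ≢ proj₁ pivot
    u≢x u≡x = contradiction (trans (sym (proj₁ P)) (trans (cong (adj G v) (sym u≡x)) (trans (adj-sym G v u) uv))) λ ()

  pinch-at : ∀ {G v w} → adj G v w ≡ false → w ≢ v → k ≤ degree G w → suc (degree G v) < k → excess G ≡ 0 → Move G
  pinch-at {G} {v} vw w≢v k≤w deficit≥2 noExcess =
    raising (transfer-add G P vw (≢-sym w≢v) (≢-sym (proj₂ (proj₂ P)))) (∑-δ+δ v v) (δ+δ-self≤ (m+n≤o⇒m≤o∸n 2 deficit≥2))
      (λ y → subst (λ x → 2 * 3 + Φ x y ≤ Φ x (y + 2)) (sym noExcess) (Φ-raise-unopposed y))
    where
    P = proj₂ (∃-pivot G (≤-trans deficit≥2 k≤w))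

  pinch-between : ∀ {G u v w} → u ≢ v → adj G u v ≡ true → adj G u w ≡ false → w ≢ u → k ≤ degree G w →
                  Low G u → Low G v → excess G ≡ 0 → Move G
  pinch-between {G} {u} {v} {w} u≢v uv uw w≢u k≤w lu lv noExcess =
    raising (transfer-add G P uw (≢-sym w≢u) u≢x) (∑-δ+δ u v) (δ+δ≤ u≢v (m<n⇒0<n∸m lu) (m<n⇒0<n∸m lv))
      (λ y → subst (λ x → 2 * 3 + Φ x y ≤ Φ x (y + 2)) (sym noExcess) (Φ-raise-unopposed y))
    where
    pivot = ∃-pivot-of-reverse G (trans (adj-sym G v u) uv) (trans (adj-sym G w u) uw) (<-≤-trans lv k≤w)
    P = proj₂ pivot
    u≢x : u ≢ proj₁ pivot
    u≢x u≡x = contradiction (trans (sym (proj₁ P)) (trans (cong (adj G w) (sym u≡x)) (trans (adj-sym G w u) uw))) λ ()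

  module _ (k<n : k < n) (2∣nk : 2 ∣ n * k) where

    excess+deficit≢1 : ∀ G → excess G + deficit G ≢ 1
    excess+deficit≢1 G e = contradiction (∣1⇒≡1 (subst (2 ∣_) e (excess+deficit-even 2∣nk G))) λ ()

    non-high-neighbour : ∀ G {x} → (∀ u v → High G u → High G v → adj G u v ≡ false) → High G x →
                         ∃ λ w → adj G x w ≡ true × degree G w ≤ k
    non-high-neighbour G {x} noAdjacent hx with ∃-neighbour G (≤-<-trans z≤n hx)
    ... | w , xw = w , xw , ≮⇒≥ (λ hw → contradiction (trans (sym xw) (noAdjacent x w hx hw)) λ ())

    non-low-non-neighbour : ∀ G {x} → (∀ u v → Low G u → Low G v → u ≢ v → adj G u v ≡ true) → Low G x →
                            ∃ λ w → adj G x w ≡ false × w ≢ x × k ≤ degree G w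
    non-low-non-neighbour G {x} noSeparated lx with ∃-non-neighbour G (≤-trans (s≤s lx) k<n)
    ... | w , xw , w≢x = w , xw , w≢x , ≮⇒≥ (λ lw → contradiction (trans (sym (noSeparated x w lx lw (≢-sym w≢x))) xw) λ ())

    highs-only : ∀ {G} → (∀ u v → High G u → High G v → adj G u v ≡ false) → (∀ i → ¬ Low G i) → ∃ (High G) → Move G
    highs-only {G} noAdjacent noLow (u , hu) with non-high-neighbour G noAdjacent hu | any? (λ v → ¬? (v ≟ u) ×-dec (k <? degree G v))
    ... | w , uw , w≤k | yes (v , v≢u , hv) = split-off-between (≢-sym v≢u) (noAdjacent u v hu hv) uw w≤k hu hv (deficit≡0 G noLow)
    ... | w , uw , w≤k | no onlyU with suc k <? degree G u
    ...   | yes excess≥2 = split-off-at uw w≤k excess≥2 (deficit≡0 G noLow)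
    ...   | no  excess≱2 = contradiction excess+deficit≡1 (excess+deficit≢1 G)
      where
      others : ∀ i → i ≢ u → degree G i ∸ k ≡ 0
      others i i≢u = m≤n⇒m∸n≡0 (≮⇒≥ (λ hi → onlyU (i , i≢u , hi)))
      excess+deficit≡1 : excess G + deficit G ≡ 1
      excess+deficit≡1 = begin
        excess G + deficit G  ≡⟨ cong₂ _+_ (∑-supported u others) (deficit≡0 G noLow) ⟩
        (degree G u ∸ k) + 0  ≡⟨ cong (λ d → (d ∸ k) + 0) (≤-antisym (≮⇒≥ excess≱2) hu) ⟩
        (suc k ∸ k) + 0       ≡⟨ cong (_+ 0) (m+n∸n≡m 1 k) ⟩
        1                     ∎
        where open ≡-Reasoning

    lows-only : ∀ {G} → (∀ u v → Low G u → Low G v → u ≢ v → adj G u v ≡ true) → (∀ i → ¬ High G i) → ∃ (Low G) → Move G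
    lows-only {G} noSeparated noHigh (v , lv) with any? (λ u → ¬? (u ≟ v) ×-dec (degree G u <? k))
    ... | yes (u , u≢v , lu) =
      let w , uw , w≢u , k≤w = non-low-non-neighbour G noSeparated lu
      in pinch-between u≢v (noSeparated u v lu lv u≢v) uw w≢u k≤w lu lv (excess≡0 G noHigh)
    ... | no onlyV with non-low-non-neighbour G noSeparated lv | suc (degree G v) <? k
    ...   | w , vw , w≢v , k≤w | yes deficit≥2 = pinch-at vw w≢v k≤w deficit≥2 (excess≡0 G noHigh)
    ...   | _                  | no  deficit≱2 = contradiction excess+deficit≡1 (excess+deficit≢1 G)
      where
      others : ∀ i → i ≢ v → k ∸ degree G i ≡ 0
      others i i≢v = m≤n⇒m∸n≡0 (≮⇒≥ (λ li → onlyV (i , i≢v , li)))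
      excess+deficit≡1 : excess G + deficit G ≡ 1
      excess+deficit≡1 = begin
        excess G + deficit G           ≡⟨ cong₂ _+_ (excess≡0 G noHigh) (∑-supported v others) ⟩
        k ∸ degree G v                 ≡⟨ cong (_∸ degree G v) (≤-antisym (≮⇒≥ deficit≱2) lv) ⟩
        suc (degree G v) ∸ degree G v  ≡⟨ m+n∸n≡m 1 (degree G v) ⟩
        1                              ∎
        where open ≡-Reasoning

    step : ∀ G → (∀ u → degree G u ≡ k) ⊎ Move G
    step G with any? (λ u → any? (λ v → (k <? degree G u) ×-dec (k <? degree G v) ×-dec (adj G u v ≟ᵇ true)))
    ... | yes (u , v , hu , hv , uv) = inj₂ (delete-high uv hu hv)
    ... | no adjacentHighs with any? (λ u → any? (λ v → (degree G u <? k) ×-dec (degree G v <? k) ×-dec ¬? (u ≟ v) ×-dec (adj G u v ≟ᵇ false)))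
    ...   | yes (u , v , lu , lv , u≢v , uv) = inj₂ (add-low u≢v uv lu lv)
    ...   | no separatedLows with any? (λ u → k <? degree G u) | any? (λ u → degree G u <? k)
    ...     | yes (u , hu) | yes (v , lv) = inj₂ (transfer-high-low hu lv)
    ...     | yes high     | no  noLow    = inj₂ (highs-only noAdjacent (λ i li → noLow (i , li)) high)
      where
      noAdjacent : ∀ u v → High G u → High G v → adj G u v ≡ false
      noAdjacent u v hu hv = ¬-not (λ uv → adjacentHighs (u , v , hu , hv , uv))
    ...     | no  noHigh   | yes low      = inj₂ (lows-only noSeparated (λ i hi → noHigh (i , hi)) low)
      where
      noSeparated : ∀ u v → Low G u → Low G v → u ≢ v → adj G u v ≡ true
      noSeparated u v lu lv u≢v = ¬-not (λ uv → separatedLows (u , v , lu , lv , u≢v , uv))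
    ...     | no  noHigh   | no  noLow    = inj₁ (λ u → ≤-antisym (≮⇒≥ (λ hu → noHigh (u , hu))) (≮⇒≥ (λ lu → noLow (u , lu))))

    regularise : ∀ G → ∃ λ R → Regular R × distance G R ≤ potential G
    regularise G = go G (<-wellFounded (potential G))
      where
      go : ∀ G → Acc _<_ (potential G) → ∃ λ R → Regular R × distance G R ≤ potential G
      go G (acc rs) with step G
      ... | inj₁ regular = G , (k , λ u → trans (deg≡degree G u) (regular u)) , subst (_≤ potential G) (sym (distance-refl G)) z≤n
      ... | inj₂ m with go (Move.next m) (rs (Move.progress m))
      ...   | R , R-regular , near = R , R-regular , (begin
        distance G R                         ≤⟨ distance-triangle G G′ R ⟩
        distance G G′ + distance G′ R        ≤⟨ +-monoʳ-≤ (distance G G′) near ⟩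
        distance G G′ + potential G′         ≤⟨ Move.paid m ⟩
        potential G                          ∎)
        where
        open ≤-Reasoning
        G′ = Move.next m

  nTimesS≡∑ : ∀ G → nTimesS G ≡ ∑[ i < n ] ∣ n * degree G i - 2 * edges G ∣
  nTimesS≡∑ G = trans (∑-listSum {n} _) (sum-cong-≗ (λ i → cong (λ d → ∣ n * d - 2 * edges G ∣) (deg≡degree G i)))

  ∣excess-deficit∣ : ∀ G → ∣ excess G - deficit G ∣ ≡ ∣ 2 * edges G - n * k ∣
  ∣excess-deficit∣ G = +≡+⇒∣-∣≡∣-∣ {x = excess G} {deficit G} (excess-deficit-balance G)

  n*excess+deficit≤ : ∀ G → n * (excess G + deficit G) ≤ nTimesS G + n * ∣ 2 * edges G - n * k ∣
  n*excess+deficit≤ G = begin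
    n * (excess G + deficit G)
      ≡⟨ cong (n *_) (∑-distrib-+ (λ i → degree G i ∸ k) (λ i → k ∸ degree G i)) ⟨
    n * ∑[ i < n ] ((degree G i ∸ k) + (k ∸ degree G i))
      ≡⟨ *-distribˡ-sum n (λ i → (degree G i ∸ k) + (k ∸ degree G i)) ⟩
    ∑[ i < n ] (n * ((degree G i ∸ k) + (k ∸ degree G i)))
      ≡⟨ sum-cong-≗ (λ i → trans (cong (n *_) (∸+∸≡∣-∣ (degree G i) k)) (*-distribˡ-∣-∣ n (degree G i) k)) ⟩
    ∑[ i < n ] ∣ n * degree G i - n * k ∣
      ≤⟨ ∑-mono-≤ (λ i → ∣-∣-triangle (n * degree G i) (2 * edges G) (n * k)) ⟩
    ∑[ i < n ] (∣ n * degree G i - 2 * edges G ∣ + E)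
      ≡⟨ ∑-distrib-+ (λ i → ∣ n * degree G i - 2 * edges G ∣) (λ _ → E) ⟩
    ∑[ i < n ] ∣ n * degree G i - 2 * edges G ∣ + ∑[ i < n ] E
      ≡⟨ cong₂ _+_ (nTimesS≡∑ G) (sym (∑-const n E)) ⟨
    nTimesS G + n * E ∎
    where
    open ≤-Reasoning
    E = ∣ 2 * edges G - n * k ∣

  potential-bound : ∀ G → n * potential G ≤ 2 * nTimesS G + 3 * (n * ∣ 2 * edges G - n * k ∣)
  potential-bound G = begin
    n * (2 * (excess G + deficit G) + ∣ excess G - deficit G ∣)
      ≡⟨ cong (λ e → n * (2 * (excess G + deficit G) + e)) (∣excess-deficit∣ G) ⟩
    n * (2 * (excess G + deficit G) + E)
      ≡⟨ solve 3 (λ n s e → n :* (con 2 :* s :+ e) := con 2 :* (n :* s) :+ n :* e) refl n (excess G + deficit G) E ⟩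
    2 * (n * (excess G + deficit G)) + n * E
      ≤⟨ +-monoˡ-≤ (n * E) (*-monoʳ-≤ 2 (n*excess+deficit≤ G)) ⟩
    2 * (nTimesS G + n * E) + n * E
      ≡⟨ solve 2 (λ s e → con 2 :* (s :+ e) :+ e := con 2 :* s :+ con 3 :* e) refl (nTimesS G) (n * E) ⟩
    2 * nTimesS G + 3 * (n * E) ∎
    where
    open ≤-Reasoning
    E = ∣ 2 * edges G - n * k ∣

-- The target degree
2∣n⊎2∣1+n : ∀ n → 2 ∣ n ⊎ 2 ∣ suc n
2∣n⊎2∣1+n zero    = inj₁ (2 ∣0)
2∣n⊎2∣1+n (suc n) with 2∣n⊎2∣1+n n
... | inj₁ (divides q n≡q*2) = inj₂ (divides (suc q) (cong (2 +_) n≡q*2))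
... | inj₂ 2∣1+n             = inj₁ 2∣1+n

¬2∣n×2∣1+n : ∀ {n} → 2 ∣ n → ¬ 2 ∣ suc n
¬2∣n×2∣1+n {n} 2∣n 2∣1+n = contradiction (∣1⇒≡1 (∣m+n∣m⇒∣n (subst (2 ∣_) (+-comm 1 n) 2∣1+n) 2∣n)) λ ()

∣-∣-bracket : ∀ {a x} m → a ≤ x → x ≤ a + m → ∣ x - a ∣ ≤ m × ∣ x - (a + m) ∣ ≤ m
∣-∣-bracket {a} {x} m a≤x x≤a+m =
  subst (_≤ m) (sym (m≤n⇒∣n-m∣≡n∸m a≤x)) (subst (x ∸ a ≤_) (m+n∸m≡n a m) (∸-monoˡ-≤ a x≤a+m)) ,
  subst (_≤ m) (sym (m≤n⇒∣m-n∣≡n∸m x≤a+m)) (subst (a + m ∸ x ≤_) (m+n∸m≡n a m) (∸-monoʳ-≤ (a + m) a≤x))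

-- k is ⌊T/n⌋ or ⌊T/n⌋ + 1, whichever makes n·k even; the latter is needed only for odd n,
-- and then ⌊T/n⌋ + 1 ≠ n since ⌊T/n⌋ is odd.
target-degree : ∀ n .{{_ : NonZero n}} T → T < n * n → ∃ λ k → k < n × 2 ∣ n * k × ∣ T - n * k ∣ ≤ n
target-degree n T T<n*n = choose (2∣n⊎2∣1+n n) (2∣n⊎2∣1+n q)
  where
  q = T / n
  q<n : q < n
  q<n = m<n*o⇒m/o<n T<n*n
  nq≤T : n * q ≤ T
  nq≤T = subst (_≤ T) (*-comm q n) (m/n*n≤m T n)
  T≤nq+n : T ≤ n * q + n
  T≤nq+n = begin
    T               ≡⟨ m≡m%n+[m/n]*n T n ⟩
    T % n + q * n   ≤⟨ +-monoˡ-≤ (q * n) (<⇒≤ (m%n<n T n)) ⟩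
    n + q * n       ≡⟨ cong (n +_) (*-comm q n) ⟩
    n + n * q       ≡⟨ +-comm n (n * q) ⟩
    n * q + n       ∎
    where open ≤-Reasoning
  bracket = ∣-∣-bracket n nq≤T T≤nq+n
  choose : 2 ∣ n ⊎ 2 ∣ suc n → 2 ∣ q ⊎ 2 ∣ suc q → ∃ λ k → k < n × 2 ∣ n * k × ∣ T - n * k ∣ ≤ n
  choose (inj₁ 2∣n) _           = q , q<n , ∣m⇒∣m*n q 2∣n , proj₁ bracket
  choose (inj₂ _)   (inj₁ 2∣q)  = q , q<n , ∣n⇒∣m*n n 2∣q , proj₁ bracket
  choose (inj₂ 2∣1+n) (inj₂ 2∣1+q) =
    suc q , ≤∧≢⇒< q<n 1+q≢n , ∣n⇒∣m*n n 2∣1+q ,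
    subst (λ m → ∣ T - m ∣ ≤ n) (sym (trans (*-suc n q) (+-comm n (n * q)))) (proj₂ bracket)
    where
    1+q≢n : suc q ≢ n
    1+q≢n 1+q≡n = ¬2∣n×2∣1+n (subst (2 ∣_) 1+q≡n 2∣1+q) 2∣1+n

2*edges<n*n : ∀ {n} .{{_ : NonZero n}} (G : Graph n) → 2 * edges G < n * n
2*edges<n*n {n@(suc n′)} G = begin-strict
  2 * edges G                                  ≡⟨ handshake G ⟨
  degree G zero + ∑[ i < n′ ] degree G (suc i)  <⟨ +-mono-<-≤ (degree<n G zero) (∑-mono-≤ (λ i → <⇒≤ (degree<n G (suc i)))) ⟩
  ∑[ i < n ] n                                 ≡⟨ ∑-const n n ⟩
  n * n                                        ∎
  where open ≤-Reasoning

corollary4 : ∀ (n : ℕ) (G : Graph n) (r : ℕ) → IsRho G r →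
    2 * n * r ≤ 2 * nTimesS G + 3 * (n * n)
corollary4 zero      G r _ = z≤n
corollary4 n@(suc _) G r (_ , minimal) with target-degree n (2 * edges G) (2*edges<n*n G)
... | k , k<n , 2∣nk , near-target with Balancing.regularise k k<n 2∣nk G
... | R , R-regular , near = begin
  2 * n * r                                                 ≤⟨ *-monoʳ-≤ (2 * n) (minimal R R-regular) ⟩
  2 * n * symDiff G R                                       ≡⟨ trans (cong (_* symDiff G R) (*-comm 2 n)) (*-assoc n 2 (symDiff G R)) ⟩
  n * (2 * symDiff G R)                                     ≡⟨ cong (n *_) (2*symDiff≡distance G R) ⟩
  n * distance G R                                          ≤⟨ *-monoʳ-≤ n near ⟩
  n * potential G                                           ≤⟨ potential-bound G ⟩
  2 * nTimesS G + 3 * (n * ∣ 2 * edges G - n * k ∣)         ≤⟨ +-monoʳ-≤ (2 * nTimesS G) (*-monoʳ-≤ 3 (*-monoʳ-≤ n near-target)) ⟩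
  2 * nTimesS G + 3 * (n * n)                               ∎
  where
  open ≤-Reasoning
  open Balancing k
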